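{- Let $m,n$ be positive integers with $3m\le n$. For any two points of $\mathcal{P}_m$ there is a point of $\mathcal{P}_m$ collinear to each of them.
   Context: $\mathbb{F}$ is the two-element field, $V=\mathbb{F}^n$ with standard basis $e_1,\dots,e_n$, $[n]=\{1,\dots,n\}$. For non-empty $I\subseteq[n]$, $e_I=\sum_{i\in I}e_i$ and $P_I$ is the point of $\mathcal{P}(V)$ spanned by $e_I$. $\mathcal{P}_m$ is the point-line geometry whose points are all $P_I$ with $|I|=2m$ and whose lines are the 3-point lines $\{P_I,P_J,P_{I\triangle J}\}$ of $\mathcal{P}(V)$ contained in this point set; distinct points $P_I,P_J$ of $\mathcal{P}_m$ are collinear iff $|I\cap J|=m$. -}

module Defs where

open import Data.Nat using (ℕ; _*_)
open import Data.Bool using (_xor_)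
open import Data.Vec using (zipWith)
open import Data.Fin.Subset using (Subset; ∣_∣)
open import Data.Product using (_×_)
open import Relation.Binary.PropositionalEquality using (_≡_; _≢_)

-- A non-empty subset I ⊆ [n] is a vector of n booleans; over 𝔽₂ the point P_I
-- (span of e_I) determines I, so points of 𝒫(V) are identified with non-empty subsets.

-- symmetric difference I △ J (corresponds to e_I + e_J)
_△_ : ∀ {n} → Subset n → Subset n → Subset n
I △ J = zipWith _xor_ I J

IsPoint : ∀ {n} → ℕ → Subset n → Set
IsPoint m I = ∣ I ∣ ≡ 2 * m

-- distinct points P_I, P_J of 𝒫_m are collinear: the 3-point line
-- {P_I, P_J, P_{I△J}} of 𝒫(V) lies in the point set of 𝒫_m
Collinear : ∀ {n} → ℕ → Subset n → Subset n → Set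
Collinear m I J = I ≢ J × IsPoint m I × IsPoint m J × IsPoint m (I △ J)

-- Split [n] into the four Venn regions of I and J, of sizes a = |I ∩ J|, b = |I ─ J|,
-- c = |J ─ I| and d = |[n] ─ (I ∪ J)|; here a + b = a + c = 2m. Two points of 𝒫_m are
-- collinear exactly when they meet in m elements, so it suffices to pick K with
-- |K| = 2m and |K ∩ I| = |K ∩ J| = m, choosing a prescribed number of elements from each
-- region. If a ≤ m take m elements from each of I ─ J and J ─ I. If a = m + t, take all of
-- I ─ J and J ─ I (m - t elements each), t elements of I ∩ J and t elements outside
-- I ∪ J; the last choice is possible because 3m ≤ n forces d ≥ t.
module Submission where

open import Defs
open import Data.Nat using (ℕ; _*_; _≤_; NonZero)
open import Data.Fin.Subset using (Subset)
open import Data.Product using (Σ; _×_)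

open import Data.Nat using (suc; _+_; _∸_; z≤n; s≤s; ≢-nonZero⁻¹)
open import Data.Nat.Properties
  using ( +-suc; +-comm; +-assoc; +-identityʳ; +-cancelˡ-≡; +-cancelˡ-≤; +-cancelʳ-≤
        ; +-monoˡ-≤; ≤-total; ≤-trans; ≤-refl; ≤-reflexive
        ; m+[n∸m]≡n; m∸n≤m; module ≤-Reasoning; m<m+n; n≢0⇒n>0; <-irrefl)
open import Data.Bool using (true; false)
open import Data.Vec using ([]; _∷_)
open import Data.Fin.Subset using (∣_∣; _∩_; _∪_; _─_; ∁)
open import Data.Fin.Subset.Properties using (∩-comm; ∩-idem)
open import Data.Product using (_,_)
open import Data.Sum using (inj₁; inj₂)
open import Relation.Binary.PropositionalEquality
  using (_≡_; _≢_; refl; sym; trans; cong; cong₂; module ≡-Reasoning)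

2*m≡m+m : ∀ m → 2 * m ≡ m + m
2*m≡m+m m = cong (m +_) (+-identityʳ m)

private
  suc-into-2nd : ∀ x y z w → suc ((x + y) + (z + w)) ≡ (x + suc y) + (z + w)
  suc-into-2nd x y z w = cong (_+ (z + w)) (sym (+-suc x y))

  suc-into-3rd : ∀ x y z w → suc ((x + y) + (z + w)) ≡ (x + y) + (suc z + w)
  suc-into-3rd x y z w = sym (+-suc (x + y) (z + w))

  suc-into-4th : ∀ x y z w → suc ((x + y) + (z + w)) ≡ (x + y) + (z + suc w)
  suc-into-4th x y z w =
    trans (suc-into-3rd x y z w) (cong ((x + y) +_) (sym (+-suc z w)))

∣p∩q∣+∣p─q∣≡∣p∣ : ∀ {n} (p q : Subset n) → ∣ p ∩ q ∣ + ∣ p ─ q ∣ ≡ ∣ p ∣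
∣p∩q∣+∣p─q∣≡∣p∣ [] [] = refl
∣p∩q∣+∣p─q∣≡∣p∣ (true ∷ p) (true ∷ q) = cong suc (∣p∩q∣+∣p─q∣≡∣p∣ p q)
∣p∩q∣+∣p─q∣≡∣p∣ (true ∷ p) (false ∷ q) =
  trans (+-suc (∣ p ∩ q ∣) (∣ p ─ q ∣)) (cong suc (∣p∩q∣+∣p─q∣≡∣p∣ p q))
∣p∩q∣+∣p─q∣≡∣p∣ (false ∷ p) (true ∷ q) = ∣p∩q∣+∣p─q∣≡∣p∣ p q
∣p∩q∣+∣p─q∣≡∣p∣ (false ∷ p) (false ∷ q) = ∣p∩q∣+∣p─q∣≡∣p∣ p q

∣p△q∣≡∣p─q∣+∣q─p∣ : ∀ {n} (p q : Subset n) → ∣ p △ q ∣ ≡ ∣ p ─ q ∣ + ∣ q ─ p ∣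
∣p△q∣≡∣p─q∣+∣q─p∣ [] [] = refl
∣p△q∣≡∣p─q∣+∣q─p∣ (true ∷ p) (true ∷ q) = ∣p△q∣≡∣p─q∣+∣q─p∣ p q
∣p△q∣≡∣p─q∣+∣q─p∣ (true ∷ p) (false ∷ q) = cong suc (∣p△q∣≡∣p─q∣+∣q─p∣ p q)
∣p△q∣≡∣p─q∣+∣q─p∣ (false ∷ p) (true ∷ q) =
  trans (cong suc (∣p△q∣≡∣p─q∣+∣q─p∣ p q)) (sym (+-suc (∣ p ─ q ∣) (∣ q ─ p ∣)))
∣p△q∣≡∣p─q∣+∣q─p∣ (false ∷ p) (false ∷ q) = ∣p△q∣≡∣p─q∣+∣q─p∣ p q

venn-regions-cover : ∀ {n} (p q : Subset n) →
  (∣ p ∩ q ∣ + ∣ p ─ q ∣) + (∣ q ─ p ∣ + ∣ ∁ (p ∪ q) ∣) ≡ n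
venn-regions-cover [] [] = refl
venn-regions-cover (true ∷ p) (true ∷ q) = cong suc (venn-regions-cover p q)
venn-regions-cover (true ∷ p) (false ∷ q) =
  trans (sym (suc-into-2nd (∣ p ∩ q ∣) (∣ p ─ q ∣) (∣ q ─ p ∣) (∣ ∁ (p ∪ q) ∣)))
        (cong suc (venn-regions-cover p q))
venn-regions-cover (false ∷ p) (true ∷ q) =
  trans (sym (suc-into-3rd (∣ p ∩ q ∣) (∣ p ─ q ∣) (∣ q ─ p ∣) (∣ ∁ (p ∪ q) ∣)))
        (cong suc (venn-regions-cover p q))
venn-regions-cover (false ∷ p) (false ∷ q) =
  trans (sym (suc-into-4th (∣ p ∩ q ∣) (∣ p ─ q ∣) (∣ q ─ p ∣) (∣ ∁ (p ∪ q) ∣)))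
        (cong suc (venn-regions-cover p q))

pick-from-venn-regions : ∀ {n} (p q : Subset n) {x y z w : ℕ} →
  x ≤ ∣ p ∩ q ∣ → y ≤ ∣ p ─ q ∣ → z ≤ ∣ q ─ p ∣ → w ≤ ∣ ∁ (p ∪ q) ∣ →
  Σ (Subset n) λ r → ∣ r ∣ ≡ (x + y) + (z + w) × ∣ r ∩ p ∣ ≡ x + y × ∣ r ∩ q ∣ ≡ x + z
pick-from-venn-regions [] [] z≤n z≤n z≤n z≤n = [] , refl , refl , refl
pick-from-venn-regions (true ∷ p) (true ∷ q) z≤n hy hz hw
  with r , ∣r∣ , ∣r∩p∣ , ∣r∩q∣ ← pick-from-venn-regions p q z≤n hy hz hw
  = false ∷ r , ∣r∣ , ∣r∩p∣ , ∣r∩q∣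
pick-from-venn-regions (true ∷ p) (true ∷ q) (s≤s hx) hy hz hw
  with r , ∣r∣ , ∣r∩p∣ , ∣r∩q∣ ← pick-from-venn-regions p q hx hy hz hw
  = true ∷ r , cong suc ∣r∣ , cong suc ∣r∩p∣ , cong suc ∣r∩q∣
pick-from-venn-regions (true ∷ p) (false ∷ q) hx z≤n hz hw
  with r , ∣r∣ , ∣r∩p∣ , ∣r∩q∣ ← pick-from-venn-regions p q hx z≤n hz hw
  = false ∷ r , ∣r∣ , ∣r∩p∣ , ∣r∩q∣
pick-from-venn-regions (true ∷ p) (false ∷ q) {x} {suc y} {z} {w} hx (s≤s hy) hz hw
  with r , ∣r∣ , ∣r∩p∣ , ∣r∩q∣ ← pick-from-venn-regions p q hx hy hz hw
  = true ∷ r , trans (cong suc ∣r∣) (suc-into-2nd x y z w)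
             , trans (cong suc ∣r∩p∣) (sym (+-suc x y)) , ∣r∩q∣
pick-from-venn-regions (false ∷ p) (true ∷ q) hx hy z≤n hw
  with r , ∣r∣ , ∣r∩p∣ , ∣r∩q∣ ← pick-from-venn-regions p q hx hy z≤n hw
  = false ∷ r , ∣r∣ , ∣r∩p∣ , ∣r∩q∣
pick-from-venn-regions (false ∷ p) (true ∷ q) {x} {y} {suc z} {w} hx hy (s≤s hz) hw
  with r , ∣r∣ , ∣r∩p∣ , ∣r∩q∣ ← pick-from-venn-regions p q hx hy hz hw
  = true ∷ r , trans (cong suc ∣r∣) (suc-into-3rd x y z w)
             , ∣r∩p∣ , trans (cong suc ∣r∩q∣) (sym (+-suc x z))
pick-from-venn-regions (false ∷ p) (false ∷ q) hx hy hz z≤n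
  with r , ∣r∣ , ∣r∩p∣ , ∣r∩q∣ ← pick-from-venn-regions p q hx hy hz z≤n
  = false ∷ r , ∣r∣ , ∣r∩p∣ , ∣r∩q∣
pick-from-venn-regions (false ∷ p) (false ∷ q) {x} {y} {z} {suc w} hx hy hz (s≤s hw)
  with r , ∣r∣ , ∣r∩p∣ , ∣r∩q∣ ← pick-from-venn-regions p q hx hy hz hw
  = true ∷ r , trans (cong suc ∣r∣) (suc-into-4th x y z w) , ∣r∩p∣ , ∣r∩q∣

∣p∩q∣+∣p─q∣≡m+m : ∀ {n} m (p q : Subset n) → IsPoint m p → ∣ p ∩ q ∣ + ∣ p ─ q ∣ ≡ m + m
∣p∩q∣+∣p─q∣≡m+m m p q ∣p∣ = trans (∣p∩q∣+∣p─q∣≡∣p∣ p q) (trans ∣p∣ (2*m≡m+m m))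

∣p∩q∣≡m⇒collinear : ∀ {n m} .{{_ : NonZero m}} {p q : Subset n} →
  IsPoint m p → IsPoint m q → ∣ p ∩ q ∣ ≡ m → Collinear m p q
∣p∩q∣≡m⇒collinear {m = m} {p} {q} ∣p∣ ∣q∣ ∣p∩q∣ = p≢q , ∣p∣ , ∣q∣ , ∣p△q∣
  where
  open ≡-Reasoning

  ∣p─q∣≡m : ∣ p ─ q ∣ ≡ m
  ∣p─q∣≡m = +-cancelˡ-≡ m _ _ (begin
    m + ∣ p ─ q ∣           ≡⟨ cong (_+ ∣ p ─ q ∣) (sym ∣p∩q∣) ⟩
    ∣ p ∩ q ∣ + ∣ p ─ q ∣   ≡⟨ ∣p∩q∣+∣p─q∣≡m+m m p q ∣p∣ ⟩
    m + m                   ∎)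

  ∣q─p∣≡m : ∣ q ─ p ∣ ≡ m
  ∣q─p∣≡m = +-cancelˡ-≡ m _ _ (begin
    m + ∣ q ─ p ∣           ≡⟨ cong (_+ ∣ q ─ p ∣) (sym ∣p∩q∣) ⟩
    ∣ p ∩ q ∣ + ∣ q ─ p ∣   ≡⟨ cong (λ s → ∣ s ∣ + ∣ q ─ p ∣) (∩-comm p q) ⟩
    ∣ q ∩ p ∣ + ∣ q ─ p ∣   ≡⟨ ∣p∩q∣+∣p─q∣≡m+m m q p ∣q∣ ⟩
    m + m                   ∎)

  ∣p△q∣ : IsPoint m (p △ q)
  ∣p△q∣ = begin
    ∣ p △ q ∣               ≡⟨ ∣p△q∣≡∣p─q∣+∣q─p∣ p q ⟩
    ∣ p ─ q ∣ + ∣ q ─ p ∣   ≡⟨ cong₂ _+_ ∣p─q∣≡m ∣q─p∣≡m ⟩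
    m + m                   ≡⟨ sym (2*m≡m+m m) ⟩
    2 * m                   ∎

  p≢q : p ≢ q
  p≢q refl = <-irrefl m≡m+m (m<m+n m (n≢0⇒n>0 (≢-nonZero⁻¹ m)))
    where
    m≡m+m : m ≡ m + m
    m≡m+m = begin
      m           ≡⟨ sym ∣p∩q∣ ⟩
      ∣ p ∩ p ∣   ≡⟨ cong ∣_∣ (∩-idem p) ⟩
      ∣ p ∣       ≡⟨ ∣p∣ ⟩
      2 * m       ≡⟨ 2*m≡m+m m ⟩
      m + m       ∎

record VennQuota (a b c d m : ℕ) : Set where
  field
    x y z w : ℕ
    x≤a : x ≤ a
    y≤b : y ≤ b
    z≤c : z ≤ c
    w≤d : w ≤ d
    x+y≡m : x + y ≡ m
    x+z≡m : x + z ≡ m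
    z+w≡m : z + w ≡ m

open VennQuota using (x≤a; y≤b; z≤c; w≤d; x+y≡m; x+z≡m; z+w≡m)

a+b≡m+m⇒a≤m⇒m≤b : ∀ {a b m} → a + b ≡ m + m → a ≤ m → m ≤ b
a+b≡m+m⇒a≤m⇒m≤b {a} {b} {m} a+b≡m+m a≤m =
  +-cancelˡ-≤ m m b (≤-trans (≤-reflexive (sym a+b≡m+m)) (+-monoˡ-≤ b a≤m))

m+t+b≡m+m⇒t+b≡m : ∀ {m t b} → m + t + b ≡ m + m → t + b ≡ m
m+t+b≡m+m⇒t+b≡m {m} {t} {b} eq = +-cancelˡ-≡ m _ _ (trans (sym (+-assoc m t b)) eq)

venn-quota : ∀ {a b c d} m → a + b ≡ m + m → a + c ≡ m + m →
  3 * m ≤ (a + b) + (c + d) → VennQuota a b c d m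
venn-quota {a} {b} {c} {d} m a+b≡m+m a+c≡m+m 3m≤a+b+c+d with ≤-total a m
... | inj₁ a≤m = record
  { x = 0 ; y = m ; z = m ; w = 0
  ; x≤a = z≤n
  ; y≤b = a+b≡m+m⇒a≤m⇒m≤b a+b≡m+m a≤m
  ; z≤c = a+b≡m+m⇒a≤m⇒m≤b a+c≡m+m a≤m
  ; w≤d = z≤n
  ; x+y≡m = refl ; x+z≡m = refl ; z+w≡m = +-identityʳ m
  }
... | inj₂ m≤a = record
  { x = t ; y = b ; z = c ; w = t
  ; x≤a = m∸n≤m a m
  ; y≤b = ≤-refl
  ; z≤c = ≤-refl
  ; w≤d = t≤d
  ; x+y≡m = t+b≡m ; x+z≡m = t+c≡m ; z+w≡m = trans (+-comm c t) t+c≡m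
  }
  where
  open ≤-Reasoning

  t : ℕ
  t = a ∸ m

  m+t≡a : m + t ≡ a
  m+t≡a = m+[n∸m]≡n m≤a

  t+b≡m : t + b ≡ m
  t+b≡m = m+t+b≡m+m⇒t+b≡m (trans (cong (_+ b) m+t≡a) a+b≡m+m)

  t+c≡m : t + c ≡ m
  t+c≡m = m+t+b≡m+m⇒t+b≡m (trans (cong (_+ c) m+t≡a) a+c≡m+m)

  m≤c+d : m ≤ c + d
  m≤c+d = +-cancelˡ-≤ (m + m) m (c + d) (begin
    (m + m) + m       ≡⟨ +-assoc m m m ⟩
    m + (m + m)       ≡⟨ cong (m +_) (sym (2*m≡m+m m)) ⟩
    3 * m             ≤⟨ 3m≤a+b+c+d ⟩
    (a + b) + (c + d) ≡⟨ cong (_+ (c + d)) a+b≡m+m ⟩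
    (m + m) + (c + d) ∎)

  t≤d : t ≤ d
  t≤d = +-cancelʳ-≤ c t d (begin
    t + c   ≡⟨ t+c≡m ⟩
    m       ≤⟨ m≤c+d ⟩
    c + d   ≡⟨ +-comm c d ⟩
    d + c   ∎)

proposition2p1 : (m n : ℕ) → .{{NonZero m}} → 3 * m ≤ n →
    (I J : Subset n) → IsPoint m I → IsPoint m J →
    Σ (Subset n) λ K → IsPoint m K × Collinear m K I × Collinear m K J
proposition2p1 m n 3m≤n I J ∣I∣ ∣J∣
  with q ← venn-quota m
             (∣p∩q∣+∣p─q∣≡m+m m I J ∣I∣)
             (trans (cong (λ s → ∣ s ∣ + ∣ J ─ I ∣) (∩-comm I J)) (∣p∩q∣+∣p─q∣≡m+m m J I ∣J∣))
             (≤-trans 3m≤n (≤-reflexive (sym (venn-regions-cover I J))))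
  with K , ∣K∣ , ∣K∩I∣ , ∣K∩J∣ ← pick-from-venn-regions I J (x≤a q) (y≤b q) (z≤c q) (w≤d q)
  = K , ∣K∣≡2m
  , ∣p∩q∣≡m⇒collinear ∣K∣≡2m ∣I∣ (trans ∣K∩I∣ (x+y≡m q))
  , ∣p∩q∣≡m⇒collinear ∣K∣≡2m ∣J∣ (trans ∣K∩J∣ (x+z≡m q))
  where
  ∣K∣≡2m : IsPoint m K
  ∣K∣≡2m = trans ∣K∣ (trans (cong₂ _+_ (x+y≡m q) (z+w≡m q)) (sym (2*m≡m+m m)))
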